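{- Let $k$ be a positive integer and let $\mathcal{A}^{(k)}$ be the set of all $k$-block Arndt compositions (of all weights $n\ge0$). Then $$\sum_{\sigma\in\mathcal{A}^{(k)}}x^{|\sigma|}y^{\mathrm{parts}(\sigma)}=\frac{1}{1-J_k(x,y)}\sum_{j=0}^{k-1}J_j(x,y),$$ where $J_0(x,y)=1$ and $J_j(x,y)=x^{\binom{j+1}{2}}y^j\prod_{\ell=1}^j\frac{1}{1-x^{\ell}}$ for $j\geq 1$.
   Context: A composition of $n\ge0$ is a finite sequence $\sigma=(\sigma_1,\dots,\sigma_\ell)$ of positive integers summing to $n=|\sigma|$, with $\mathrm{parts}(\sigma)=\ell$ (the empty composition is the composition of $0$ with $0$ parts). For a positive integer $k$, a $k$-block Arndt composition is a composition such that $\sigma_{ki-(k-1)}>\sigma_{ki-(k-2)}>\cdots>\sigma_{ki}$ for each positive integer $i$, where only the indices not exceeding $\ell$ are involved; equivalently, $\sigma_j>\sigma_{j+1}$ for every $j$ with $1\le j<\ell$ that is not a multiple of $k$ (so each consecutive block of $k$ parts, including a final incomplete block, is strictly decreasing). -}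

module Defs where

open import Data.Nat as ℕ using (ℕ; zero; suc; _∸_; _<ᵇ_; _≡ᵇ_)
open import Data.Nat.Divisibility using (_∣?_)
open import Data.Nat.Combinatorics using (_C_)
open import Data.Integer as ℤ using (ℤ; +_)
open import Data.Bool using (Bool; true; false; _∧_; if_then_else_; not; T)
open import Data.List using (List; []; _∷_; length)
open import Data.Nat.ListAction using (sum)
open import Data.Bool.ListAction using (all)
open import Data.Fin using (Fin)
open import Data.Product using (Σ)
open import Relation.Nullary using (does)

isComposition : List ℕ → Bool
isComposition σ = all (λ a → 0 <ᵇ a) σ

-- adjacentOK k i σ: σ is the tail of a composition whose head sits at
-- (1-based) position i; checks σ_j > σ_{j+1} for every j that is not a
-- multiple of k.
adjacentOK : ℕ → ℕ → List ℕ → Bool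
adjacentOK k i []           = true
adjacentOK k i (a ∷ [])     = true
adjacentOK k i (a ∷ b ∷ σ)  =
  (if does (k ∣? i) then true else (b <ᵇ a)) ∧ adjacentOK k (suc i) (b ∷ σ)

isArndt : ℕ → List ℕ → Bool
isArndt k σ = isComposition σ ∧ adjacentOK k 1 σ

Arndt : ℕ → ℕ → ℕ → Set
Arndt k n m = Σ (List ℕ) λ σ → T (isArndt k σ ∧ (sum σ ≡ᵇ n) ∧ (length σ ≡ᵇ m))

-- Formal power series in x, y with integer coefficients:
-- f n m is the coefficient of x^n y^m.

Series : Set
Series = ℕ → ℕ → ℤ

sumTo : ℕ → (ℕ → ℤ) → ℤ
sumTo zero    f = f 0
sumTo (suc n) f = sumTo n f ℤ.+ f (suc n)

one : Series
one zero zero = + 1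
one _    _    = + 0

mono : ℕ → ℕ → Series
mono a b n m = if (a ≡ᵇ n) ∧ (b ≡ᵇ m) then + 1 else + 0

_⊕_ : Series → Series → Series
(f ⊕ g) n m = f n m ℤ.+ g n m

_⊗_ : Series → Series → Series
(f ⊗ g) n m = sumTo n λ a → sumTo m λ b → f a b ℤ.* g (n ∸ a) (m ∸ b)

_^ˢ_ : Series → ℕ → Series
f ^ˢ zero  = one
f ^ˢ suc t = f ⊗ (f ^ˢ t)

-- 1/(1-g) = Σ_t g^t, for g with zero constant term (then the
-- coefficient of x^n y^m only receives contributions from t ≤ n+m).
geom : Series → Series
geom g n m = sumTo (n ℕ.+ m) λ t → (g ^ˢ t) n m

prodGeom : ℕ → Series
prodGeom zero    = one
prodGeom (suc j) = prodGeom j ⊗ geom (mono (suc j) 0)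

J : ℕ → Series
J zero    = one
J (suc j) = mono ((suc j ℕ.+ 1) C 2) (suc j) ⊗ prodGeom (suc j)

sumJ : ℕ → Series
sumJ zero    = λ _ _ → + 0
sumJ (suc k) = sumJ k ⊕ J k

rhs : ℕ → Series
rhs k = geom (J k) ⊗ sumJ k

-- A k-block Arndt composition is, uniquely, a sequence of complete blocks followed by one
-- incomplete block, each block being a strictly decreasing composition, i.e. a partition into
-- distinct parts; complete blocks have k parts and the last block has j < k parts. A partition
-- into j distinct parts is the staircase j, j-1, ..., 1 (weight x^C(j+1,2) y^j) plus a partition
-- into parts of size at most j, read column by column, so it is counted by J_j. Hence the blocks
-- contribute 1/(1 - J_k) and the last block contributes J_0 + ... + J_(k-1).
-- The counting is bijective: a class of weighted objects has generating function f when the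
-- coefficient of x^n y^m counts its objects of weight (n, m); disjoint unions, products and
-- sequences of classes realise ⊕, ⊗ and geom, and weight-preserving bijections transport
-- generating functions.
module Submission where

open import Defs
open import Algebra.Bundles using (CommutativeMonoid)
open import Data.Bool using (Bool; true; false; T; _∧_; if_then_else_)
open import Data.Bool.ListAction using (all)
open import Data.Bool.Properties using (T-∧; T-irrelevant; ∧-assoc; ∧-commutativeMonoid)
open import Data.Empty using (⊥)
open import Data.Fin using (Fin)
open import Data.Fin.Properties using (0↔⊥; 1↔⊤; +↔⊎; *↔×)
open import Data.Integer as ℤ using (ℤ)
open import Data.Integer.Properties using (pos-+; pos-*)
open import Data.List using (List; []; _∷_; _++_; _∷ʳ_; length; map; take; drop; initLast; _∷ʳ′_)
open import Data.List.Properties using (∷-injective; ∷ʳ-injective; length-map; length-++; length-++-≤ˡ)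
open import Data.List.Properties using (length-take; length-drop; map-injective; take++drop≡id)
open import Data.List.Relation.Unary.All as All using (All; []; _∷_)
import Data.List.Relation.Unary.All.Properties as All
open import Data.List.Relation.Unary.Linked as Linked using (Linked; []; [-]; _∷_)
open import Data.Nat using (ℕ; zero; suc; _+_; _*_; _∸_; _≤_; _<_; _>_; z≤n; s≤s; _<ᵇ_; _≡ᵇ_; _≟_; _<?_)
open import Data.Nat.Combinatorics using (_C_; nCk+nC[k+1]≡[n+1]C[k+1]; nC1≡n)
open import Data.Nat.Divisibility using (_∣?_; ∣-refl; >⇒∤; ∣m+n∣m⇒∣n; ∣m∣n⇒∣m+n)
open import Data.Nat.ListAction using (sum)
open import Data.Nat.ListAction.Properties using (sum-++)
open import Data.Nat.Properties
open import Data.Nat.Solver using (module +-*-Solver)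
open import Data.Product using (Σ; _×_; _,_; proj₁; proj₂; map₁)
open import Data.Product.Function.Dependent.Propositional using (Σ-↔)
open import Data.Product.Function.NonDependent.Propositional using (_×-⇔_; _×-↔_)
open import Data.Sum using (_⊎_; inj₁; inj₂; [_,_])
open import Data.Sum.Function.Propositional using (_⊎-↔_)
open import Data.Unit using (⊤; tt)
open import Function using (_∘_)
open import Function.Bundles using (_↔_; _⇔_; mk↔ₛ′; mk⇔; Inverse; Equivalence)
open import Function.Properties.Equivalence
  using () renaming (refl to ⇔-refl; sym to ⇔-sym; trans to ⇔-trans)
open import Function.Properties.Inverse using (↔-refl; ↔-sym; ↔-trans)
open import Function.Related.TypeIsomorphisms using (Σ-assoc; Σ-distribʳ-⊎)
open import Relation.Binary.PropositionalEquality hiding ([_]; J)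
open import Relation.Nullary using (yes; no; contradiction)
open import Relation.Nullary.Decidable using (dec-true; dec-false; does-⇔)
open import Relation.Nullary.Irrelevant using (Irrelevant)
open import Algebra.Properties.CommutativeSemigroup
  (CommutativeMonoid.commutativeSemigroup ∧-commutativeMonoid)
  using () renaming (interchange to ∧-interchange)
open import Algebra.Properties.CommutativeSemigroup +-commutativeSemigroup
  using () renaming (interchange to +-interchange)

private
  variable
    A B : Set
    z w : ℤ

-- Finite cardinalities

HasCard : Set → ℤ → Set
HasCard A z = Σ ℕ λ c → (Fin c ↔ A) × (ℤ.+ c ≡ z)

HasCard-↔ : HasCard A z → A ↔ B → HasCard B z
HasCard-↔ (c , Fin↔A , c≡z) A↔B = c , ↔-trans Fin↔A A↔B , c≡z

HasCard-⊎ : HasCard A z → HasCard B w → HasCard (A ⊎ B) (z ℤ.+ w)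
HasCard-⊎ (c , f , refl) (d , g , refl) = c + d , ↔-trans +↔⊎ (f ⊎-↔ g) , pos-+ c d

HasCard-× : HasCard A z → HasCard B w → HasCard (A × B) (z ℤ.* w)
HasCard-× (c , f , refl) (d , g , refl) = c * d , ↔-trans *↔× (f ×-↔ g) , pos-* c d

HasCard-T : ∀ b → HasCard (T b) (if b then ℤ.+ 1 else ℤ.+ 0)
HasCard-T true  = 1 , 1↔⊤ , refl
HasCard-T false = 0 , 0↔⊥ , refl

⇔⇒↔ : Irrelevant A → Irrelevant B → A ⇔ B → A ↔ B
⇔⇒↔ irrA irrB A⇔B = mk↔ₛ′ to from (λ b → irrB _ b) (λ a → irrA _ a)
  where open Equivalence A⇔B

×-irrelevant : Irrelevant A → Irrelevant B → Irrelevant (A × B)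
×-irrelevant irrA irrB (a , b) (a′ , b′) = cong₂ _,_ (irrA a a′) (irrB b b′)

Σ-≡-irrelevant : {P : A → Set} → (∀ {a} → Irrelevant (P a)) →
                 {p q : Σ A P} → proj₁ p ≡ proj₁ q → p ≡ q
Σ-≡-irrelevant irr {a , p} {.a , q} refl = cong (a ,_) (irr p q)

T-≡ᵇ : ∀ {m n} → T (m ≡ᵇ n) ⇔ m ≡ n
T-≡ᵇ = mk⇔ (≡ᵇ⇒≡ _ _) (≡⇒≡ᵇ _ _)

Σ≤ : ℕ → (ℕ → Set) → Set
Σ≤ N F = Σ ℕ λ i → i ≤ N × F i

Σ≤-zero : ∀ {F} → Σ≤ 0 F ↔ F 0
Σ≤-zero {F} = mk↔ₛ′ to (λ x → 0 , z≤n , x) (λ _ → refl) from-to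
  where
  to : Σ≤ 0 F → F 0
  to (zero , _ , x) = x
  from-to : ∀ p → (0 , z≤n , to p) ≡ p
  from-to (zero , z≤n , x) = refl

Σ≤-suc : ∀ {N F} → Σ≤ (suc N) F ↔ (Σ≤ N F ⊎ F (suc N))
Σ≤-suc {N} {F} = mk↔ₛ′ to from to-from from-to
  where
  to : Σ≤ (suc N) F → Σ≤ N F ⊎ F (suc N)
  to (i , i≤1+N , x) with i ≟ suc N
  ... | yes refl = inj₂ x
  ... | no i≢1+N = inj₁ (i , ≤-pred (≤∧≢⇒< i≤1+N i≢1+N) , x)
  from : Σ≤ N F ⊎ F (suc N) → Σ≤ (suc N) F
  from (inj₁ (i , i≤N , x)) = i , m≤n⇒m≤1+n i≤N , x
  from (inj₂ x)             = suc N , ≤-refl , x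
  to-from : ∀ p → to (from p) ≡ p
  to-from (inj₁ (i , i≤N , x)) with i ≟ suc N
  ... | yes refl = contradiction i≤N (<-irrefl refl)
  ... | no _     = cong (λ q → inj₁ (i , q , x)) (≤-irrelevant _ _)
  to-from (inj₂ x) with suc N ≟ suc N
  ... | yes refl = refl
  ... | no 1+N≢1+N = contradiction refl 1+N≢1+N
  from-to : ∀ p → from (to p) ≡ p
  from-to (i , _ , x) with i ≟ suc N
  ... | yes refl = cong (λ q → suc N , q , x) (≤-irrelevant _ _)
  ... | no _     = cong (λ q → i , q , x) (≤-irrelevant _ _)

HasCard-Σ≤ : ∀ N {F : ℕ → Set} {f : ℕ → ℤ} →
             (∀ i → i ≤ N → HasCard (F i) (f i)) → HasCard (Σ≤ N F) (sumTo N f)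
HasCard-Σ≤ zero    card = HasCard-↔ (card 0 z≤n) (↔-sym Σ≤-zero)
HasCard-Σ≤ (suc N) card = HasCard-↔
  (HasCard-⊎ (HasCard-Σ≤ N λ i i≤N → card i (m≤n⇒m≤1+n i≤N)) (card (suc N) ≤-refl))
  (↔-sym Σ≤-suc)

-- Weighted classes and their generating functions

record Class : Set₁ where
  field
    Obj  : Set
    xdeg : Obj → ℕ
    ydeg : Obj → ℕ
open Class public

Fiber : Class → ℕ → ℕ → Set
Fiber X n m = Σ (Obj X) λ a → xdeg X a ≡ n × ydeg X a ≡ m

HasGF : Class → Series → Set
HasGF X f = ∀ n m → HasCard (Fiber X n m) (f n m)

Fiber-≡ : ∀ {X n m} {p q : Fiber X n m} → proj₁ p ≡ proj₁ q → p ≡ q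
Fiber-≡ = Σ-≡-irrelevant (×-irrelevant ≡-irrelevant ≡-irrelevant)

∅ᶜ : Class
∅ᶜ = record { Obj = ⊥ ; xdeg = λ () ; ydeg = λ () }

Atom : ℕ → ℕ → Class
Atom a b = record { Obj = ⊤ ; xdeg = λ _ → a ; ydeg = λ _ → b }

_⊎ᶜ_ : Class → Class → Class
X ⊎ᶜ Y = record { Obj = Obj X ⊎ Obj Y ; xdeg = [ xdeg X , xdeg Y ] ; ydeg = [ ydeg X , ydeg Y ] }

_×ᶜ_ : Class → Class → Class
X ×ᶜ Y = record
  { Obj  = Obj X × Obj Y
  ; xdeg = λ (a , b) → xdeg X a + xdeg Y b
  ; ydeg = λ (a , b) → ydeg X a + ydeg Y b
  }

_^ᶜ_ : Class → ℕ → Class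
X ^ᶜ zero  = Atom 0 0
X ^ᶜ suc t = X ×ᶜ (X ^ᶜ t)

Seq : Class → Class
Seq X = record
  { Obj  = Σ ℕ λ t → Obj (X ^ᶜ t)
  ; xdeg = λ (t , as) → xdeg (X ^ᶜ t) as
  ; ydeg = λ (t , as) → ydeg (X ^ᶜ t) as
  }

Positive : Class → Set
Positive X = ∀ a → 1 ≤ xdeg X a + ydeg X a

HasGF-∅ : HasGF ∅ᶜ (λ _ _ → ℤ.+ 0)
HasGF-∅ n m = HasCard-↔ (HasCard-T false) (mk↔ₛ′ (λ ()) (λ { (() , _) }) (λ { (() , _) }) (λ ()))

HasGF-Atom : ∀ a b → HasGF (Atom a b) (mono a b)
HasGF-Atom a b n m = HasCard-↔ (HasCard-T ((a ≡ᵇ n) ∧ (b ≡ᵇ m)))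
  (↔-trans (⇔⇒↔ T-irrelevant (×-irrelevant ≡-irrelevant ≡-irrelevant)
                (⇔-trans T-∧ (T-≡ᵇ ×-⇔ T-≡ᵇ)))
           (mk↔ₛ′ (tt ,_) proj₂ (λ _ → refl) (λ _ → refl)))

mono-0-0 : ∀ n m → mono 0 0 n m ≡ one n m
mono-0-0 zero    zero    = refl
mono-0-0 zero    (suc m) = refl
mono-0-0 (suc n) zero    = refl
mono-0-0 (suc n) (suc m) = refl

HasGF-one : HasGF (Atom 0 0) one
HasGF-one n m = subst (HasCard _) (mono-0-0 n m) (HasGF-Atom 0 0 n m)

HasGF-⊎ : ∀ {X Y f g} → HasGF X f → HasGF Y g → HasGF (X ⊎ᶜ Y) (f ⊕ g)
HasGF-⊎ gfX gfY n m = HasCard-↔ (HasCard-⊎ (gfX n m) (gfY n m)) (↔-sym Σ-distribʳ-⊎)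

Convolution : Class → Class → ℕ → ℕ → Set
Convolution X Y n m = Σ≤ n λ a → Σ≤ m λ b → Fiber X a b × Fiber Y (n ∸ a) (m ∸ b)

Fiber-×-↔ : ∀ X Y n m → Fiber (X ×ᶜ Y) n m ↔ Convolution X Y n m
Fiber-×-↔ X Y n m = mk↔ₛ′ to from to-from (λ _ → Fiber-≡ refl)
  where
  to : Fiber (X ×ᶜ Y) n m → Convolution X Y n m
  to ((a , b) , x≡n , y≡m) =
    xdeg X a , subst (xdeg X a ≤_) x≡n (m≤m+n _ _) ,
    ydeg X a , subst (ydeg X a ≤_) y≡m (m≤m+n _ _) ,
    (a , refl , refl) ,
    (b , sym (trans (cong (_∸ xdeg X a) (sym x≡n)) (m+n∸m≡n (xdeg X a) _))
       , sym (trans (cong (_∸ ydeg X a) (sym y≡m)) (m+n∸m≡n (ydeg X a) _)))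
  from : Convolution X Y n m → Fiber (X ×ᶜ Y) n m
  from (_ , i≤n , _ , j≤m , (a , refl , refl) , (b , x≡n∸i , y≡m∸j)) =
    (a , b) , trans (cong (xdeg X a +_) x≡n∸i) (m+[n∸m]≡n i≤n)
            , trans (cong (ydeg X a +_) y≡m∸j) (m+[n∸m]≡n j≤m)
  to-from : ∀ p → to (from p) ≡ p
  to-from (_ , _ , _ , _ , (a , refl , refl) , (b , _)) =
    cong₂ (λ (i≤n , j≤m) fb → xdeg X a , i≤n , ydeg X a , j≤m , (a , refl , refl) , fb)
          (cong₂ _,_ (≤-irrelevant _ _) (≤-irrelevant _ _)) (Fiber-≡ refl)

HasGF-× : ∀ {X Y f g} → HasGF X f → HasGF Y g → HasGF (X ×ᶜ Y) (f ⊗ g)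
HasGF-× {X} {Y} gfX gfY n m = HasCard-↔
  (HasCard-Σ≤ n λ i _ → HasCard-Σ≤ m λ j _ → HasCard-× (gfX i j) (gfY (n ∸ i) (m ∸ j)))
  (↔-sym (Fiber-×-↔ X Y n m))

HasGF-^ : ∀ {X f} → HasGF X f → ∀ t → HasGF (X ^ᶜ t) (f ^ˢ t)
HasGF-^ gf zero    = HasGF-one
HasGF-^ gf (suc t) = HasGF-× gf (HasGF-^ gf t)

^ᶜ-weight≥exponent : ∀ {X} → Positive X → ∀ t as → t ≤ xdeg (X ^ᶜ t) as + ydeg (X ^ᶜ t) as
^ᶜ-weight≥exponent pos zero    _        = z≤n
^ᶜ-weight≥exponent {X} pos (suc t) (a , as) = subst (suc t ≤_)
  (+-interchange (xdeg X a) (ydeg X a) (xdeg (X ^ᶜ t) as) (ydeg (X ^ᶜ t) as))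
  (+-mono-≤ (pos a) (^ᶜ-weight≥exponent pos t as))

Fiber-Seq-↔ : ∀ {X} → Positive X → ∀ n m → Fiber (Seq X) n m ↔ Σ≤ (n + m) λ t → Fiber (X ^ᶜ t) n m
Fiber-Seq-↔ {X} pos n m = mk↔ₛ′ to from to-from (λ _ → refl)
  where
  to : Fiber (Seq X) n m → Σ≤ (n + m) λ t → Fiber (X ^ᶜ t) n m
  to ((t , as) , x≡n , y≡m) =
    t , subst (t ≤_) (cong₂ _+_ x≡n y≡m) (^ᶜ-weight≥exponent pos t as) , as , x≡n , y≡m
  from : (Σ≤ (n + m) λ t → Fiber (X ^ᶜ t) n m) → Fiber (Seq X) n m
  from (t , _ , as , weight) = (t , as) , weight
  to-from : ∀ p → to (from p) ≡ p
  to-from (t , _ , fib) = cong (λ t≤n+m → t , t≤n+m , fib) (≤-irrelevant _ _)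

HasGF-Seq : ∀ {X f} → Positive X → HasGF X f → HasGF (Seq X) (geom f)
HasGF-Seq pos gf n m =
  HasCard-↔ (HasCard-Σ≤ (n + m) λ t _ → HasGF-^ gf t n m) (↔-sym (Fiber-Seq-↔ pos n m))

record _≅_ (X Y : Class) : Set where
  field
    bijection : Obj X ↔ Obj Y
    xdeg-to   : ∀ a → xdeg Y (Inverse.to bijection a) ≡ xdeg X a
    ydeg-to   : ∀ a → ydeg Y (Inverse.to bijection a) ≡ ydeg X a

Fiber-≅ : ∀ {X Y} → X ≅ Y → ∀ n m → Fiber X n m ↔ Fiber Y n m
Fiber-≅ {X} {Y} X≅Y n m = Σ-↔ bijection λ {a} → ≡-↔ (sym (xdeg-to a)) ×-↔ ≡-↔ (sym (ydeg-to a))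
  where
  open _≅_ X≅Y
  ≡-↔ : ∀ {u v w : ℕ} → u ≡ v → (u ≡ w) ↔ (v ≡ w)
  ≡-↔ refl = ↔-refl

HasGF-≅ : ∀ {X Y f} → HasGF X f → X ≅ Y → HasGF Y f
HasGF-≅ gf X≅Y n m = HasCard-↔ (gf n m) (Fiber-≅ X≅Y n m)

≅-refl : ∀ {X} → X ≅ X
≅-refl = record { bijection = ↔-refl ; xdeg-to = λ _ → refl ; ydeg-to = λ _ → refl }

≅-trans : ∀ {X Y Z} → X ≅ Y → Y ≅ Z → X ≅ Z
≅-trans X≅Y Y≅Z = record
  { bijection = ↔-trans (bijection X≅Y) (bijection Y≅Z)
  ; xdeg-to   = λ a → trans (xdeg-to Y≅Z _) (xdeg-to X≅Y a)
  ; ydeg-to   = λ a → trans (ydeg-to Y≅Z _) (ydeg-to X≅Y a)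
  }
  where open _≅_

≅-⊎ : ∀ {X X′ Y Y′} → X ≅ X′ → Y ≅ Y′ → (X ⊎ᶜ Y) ≅ (X′ ⊎ᶜ Y′)
≅-⊎ X≅X′ Y≅Y′ = record
  { bijection = bijection X≅X′ ⊎-↔ bijection Y≅Y′
  ; xdeg-to   = [ xdeg-to X≅X′ , xdeg-to Y≅Y′ ]
  ; ydeg-to   = [ ydeg-to X≅X′ , ydeg-to Y≅Y′ ]
  }
  where open _≅_

≅-× : ∀ {X X′ Y Y′} → X ≅ X′ → Y ≅ Y′ → (X ×ᶜ Y) ≅ (X′ ×ᶜ Y′)
≅-× X≅X′ Y≅Y′ = record
  { bijection = bijection X≅X′ ×-↔ bijection Y≅Y′
  ; xdeg-to   = λ (a , b) → cong₂ _+_ (xdeg-to X≅X′ a) (xdeg-to Y≅Y′ b)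
  ; ydeg-to   = λ (a , b) → cong₂ _+_ (ydeg-to X≅X′ a) (ydeg-to Y≅Y′ b)
  }
  where open _≅_

≅-^ : ∀ {X Y} → X ≅ Y → ∀ t → (X ^ᶜ t) ≅ (Y ^ᶜ t)
≅-^ X≅Y zero    = ≅-refl
≅-^ X≅Y (suc t) = ≅-× X≅Y (≅-^ X≅Y t)

≅-Seq : ∀ {X Y} → X ≅ Y → Seq X ≅ Seq Y
≅-Seq X≅Y = record
  { bijection = mk↔ₛ′ (λ (t , as) → t , to t as) (λ (t , bs) → t , from t bs)
                      (λ (t , bs) → cong (t ,_) (strictlyInverseˡ t bs))
                      (λ (t , as) → cong (t ,_) (strictlyInverseʳ t as))
  ; xdeg-to   = λ (t , as) → _≅_.xdeg-to (≅-^ X≅Y t) as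
  ; ydeg-to   = λ (t , as) → _≅_.ydeg-to (≅-^ X≅Y t) as
  }
  where open module Inv t = Inverse (_≅_.bijection (≅-^ X≅Y t))

Multiples : ℕ → Class
Multiples a = record { Obj = ℕ ; xdeg = λ c → c * a ; ydeg = λ _ → 0 }

Seq-Atom≅Multiples : ∀ a → Seq (Atom a 0) ≅ Multiples a
Seq-Atom≅Multiples a = record
  { bijection = mk↔ₛ′ proj₁ (λ t → t , unit t) (λ _ → refl) (λ (t , u) → cong (t ,_) (unit-unique t u))
  ; xdeg-to   = λ (t , u) → sym (xdeg-unit t u)
  ; ydeg-to   = λ (t , u) → sym (ydeg-unit t u)
  }
  where
  unit : ∀ t → Obj (Atom a 0 ^ᶜ t)
  unit zero    = tt
  unit (suc t) = tt , unit t
  unit-unique : ∀ t u → unit t ≡ u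
  unit-unique zero    tt       = refl
  unit-unique (suc t) (tt , u) = cong (tt ,_) (unit-unique t u)
  xdeg-unit : ∀ t u → xdeg (Atom a 0 ^ᶜ t) u ≡ t * a
  xdeg-unit zero    _        = refl
  xdeg-unit (suc t) (tt , u) = cong (a +_) (xdeg-unit t u)
  ydeg-unit : ∀ t u → ydeg (Atom a 0 ^ᶜ t) u ≡ 0
  ydeg-unit zero    _        = refl
  ydeg-unit (suc t) (tt , u) = ydeg-unit t u

ProdGeomᶜ : ℕ → Class
ProdGeomᶜ zero    = Atom 0 0
ProdGeomᶜ (suc j) = ProdGeomᶜ j ×ᶜ Multiples (suc j)

HasGF-prodGeom : ∀ j → HasGF (ProdGeomᶜ j) (prodGeom j)
HasGF-prodGeom zero    = HasGF-one
HasGF-prodGeom (suc j) = HasGF-× (HasGF-prodGeom j)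
  (HasGF-≅ (HasGF-Seq (λ _ → s≤s z≤n) (HasGF-Atom (suc j) 0)) (Seq-Atom≅Multiples (suc j)))

Jᶜ : ℕ → Class
Jᶜ zero    = Atom 0 0
Jᶜ (suc j) = Atom ((suc j + 1) C 2) (suc j) ×ᶜ ProdGeomᶜ (suc j)

HasGF-J : ∀ j → HasGF (Jᶜ j) (J j)
HasGF-J zero    = HasGF-one
HasGF-J (suc j) = HasGF-× (HasGF-Atom ((suc j + 1) C 2) (suc j)) (HasGF-prodGeom (suc j))

Jᶜ-positive : ∀ {j} → 1 ≤ j → Positive (Jᶜ j)
Jᶜ-positive {suc j} _ (_ , e) = ≤-trans (s≤s z≤n) (m≤n+m (suc j + ydeg (ProdGeomᶜ (suc j)) e) _)

SumJᶜ : ℕ → Class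
SumJᶜ zero    = ∅ᶜ
SumJᶜ (suc k) = SumJᶜ k ⊎ᶜ Jᶜ k

HasGF-sumJ : ∀ k → HasGF (SumJᶜ k) (sumJ k)
HasGF-sumJ zero    = HasGF-∅
HasGF-sumJ (suc k) = HasGF-⊎ (HasGF-sumJ k) (HasGF-J k)

HasGF-rhs : ∀ {k} → 1 ≤ k → HasGF (Seq (Jᶜ k) ×ᶜ SumJᶜ k) (rhs k)
HasGF-rhs {k} k≥1 = HasGF-× (HasGF-Seq (Jᶜ-positive k≥1) (HasGF-J k)) (HasGF-sumJ k)

ListClass : (List ℕ → Set) → Class
ListClass P = record { Obj = Σ (List ℕ) P ; xdeg = sum ∘ proj₁ ; ydeg = length ∘ proj₁ }

record ListEncoding (X : Class) (P : List ℕ → Set) : Set where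
  field
    encode           : Obj X → List ℕ
    encode-valid     : ∀ a → P (encode a)
    encode-injective : ∀ {a b} → encode a ≡ encode b → a ≡ b
    decode           : ∀ σ → P σ → Σ (Obj X) λ a → encode a ≡ σ
    sum-encode       : ∀ a → sum (encode a) ≡ xdeg X a
    length-encode    : ∀ a → length (encode a) ≡ ydeg X a

ListEncoding⇒≅ : ∀ {X P} → (∀ {σ} → Irrelevant (P σ)) → ListEncoding X P → X ≅ ListClass P
ListEncoding⇒≅ irr E = record
  { bijection = mk↔ₛ′ (λ a → encode a , encode-valid a) (λ (σ , p) → proj₁ (decode σ p))
                      (λ (σ , p) → Σ-≡-irrelevant irr (proj₂ (decode σ p)))
                      (λ a → encode-injective (proj₂ (decode (encode a) (encode-valid a))))
  ; xdeg-to   = sum-encode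
  ; ydeg-to   = length-encode
  }
  where open ListEncoding E

-- Partitions into distinct parts

length-∷ʳ : ∀ (τ : List A) {l} → length (τ ∷ʳ l) ≡ suc (length τ)
length-∷ʳ τ = trans (length-++ τ) (+-comm (length τ) 1)

map-+-∸ : ∀ {l τ} → All (l ≤_) τ → map (l +_) (map (_∸ l) τ) ≡ τ
map-+-∸ []           = refl
map-+-∸ (l≤x ∷ l≤τ) = cong₂ _∷_ (m+[n∸m]≡n l≤x) (map-+-∸ l≤τ)

DistinctParts : List ℕ → Set
DistinctParts σ = All (0 <_) σ × Linked _>_ σ

DistinctParts-irrelevant : ∀ {σ} → Irrelevant (DistinctParts σ)
DistinctParts-irrelevant = ×-irrelevant (All.irrelevant ≤-irrelevant) (Linked.irrelevant <-irrelevant)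

DistinctOfLength-irrelevant : ∀ {j σ} → Irrelevant (DistinctParts σ × length σ ≡ j)
DistinctOfLength-irrelevant = ×-irrelevant DistinctParts-irrelevant ≡-irrelevant

DistinctShorterThan-irrelevant : ∀ {k σ} → Irrelevant (DistinctParts σ × length σ < k)
DistinctShorterThan-irrelevant = ×-irrelevant DistinctParts-irrelevant <-irrelevant

DistinctOfLength : ℕ → Class
DistinctOfLength j = ListClass λ σ → DistinctParts σ × length σ ≡ j

DistinctShorterThan : ℕ → Class
DistinctShorterThan k = ListClass λ σ → DistinctParts σ × length σ < k

Linked-shift : ∀ s {τ} → All (0 <_) τ → Linked _>_ τ → Linked _>_ (map (s +_) τ ∷ʳ s)
Linked-shift s {[]}        _          _              = [-]
Linked-shift s {_ ∷ []}    (x>0 ∷ []) _              = m<m+n s x>0 ∷ [-]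
Linked-shift s {_ ∷ _ ∷ _} (_ ∷ pos)  (y<x ∷ linked) = +-monoʳ-< s y<x ∷ Linked-shift s pos linked

DistinctParts-shift : ∀ s {τ} → 0 < s → DistinctParts τ → DistinctParts (map (s +_) τ ∷ʳ s)
DistinctParts-shift s {τ} s>0 (pos , linked) =
  All.++⁺ (All.map⁺ (All.universal (λ x → <-≤-trans s>0 (m≤m+n s x)) τ)) (s>0 ∷ []) ,
  Linked-shift s pos linked

Linked-∷ʳ⇒All : ∀ {l} τ → Linked _>_ (τ ∷ʳ l) → All (l <_) τ
Linked-∷ʳ⇒All []          _              = []
Linked-∷ʳ⇒All (_ ∷ [])    (l<x ∷ _)      = l<x ∷ []
Linked-∷ʳ⇒All (_ ∷ y ∷ τ) (y<x ∷ linked) with l<y ∷ l<τ ← Linked-∷ʳ⇒All (y ∷ τ) linked =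
  <-trans l<y y<x ∷ l<y ∷ l<τ

Linked-unshift : ∀ l τ → Linked _>_ (τ ∷ʳ l) → Linked _>_ (map (_∸ l) τ)
Linked-unshift l []          _              = []
Linked-unshift l (_ ∷ [])    _              = [-]
Linked-unshift l (_ ∷ y ∷ τ) (y<x ∷ linked) =
  ∸-monoˡ-< y<x (<⇒≤ (All.head (Linked-∷ʳ⇒All (y ∷ τ) linked))) ∷ Linked-unshift l (y ∷ τ) linked

DistinctParts-unshift : ∀ l τ → DistinctParts (τ ∷ʳ l) → DistinctParts (map (_∸ l) τ)
DistinctParts-unshift l τ (_ , linked) =
  All.map⁺ (All.map m<n⇒0<n∸m (Linked-∷ʳ⇒All τ linked)) , Linked-unshift l τ linked

-- (c₁, ..., c_j) ↦ the staircase j, j-1, ..., 1 with c_ℓ added to each of its ℓ largest parts,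
-- i.e. the parts j + c₁ + ... + c_j, ..., 1 + c_j; the coordinate c_ℓ has weight x^(ℓ c_ℓ).
distinct : ∀ j → Obj (ProdGeomᶜ j) → List ℕ
distinct zero    _       = []
distinct (suc j) (e , c) = map (suc c +_) (distinct j e) ∷ʳ suc c

length-distinct : ∀ j e → length (distinct j e) ≡ j
length-distinct zero    _       = refl
length-distinct (suc j) (e , c) = trans (length-∷ʳ (map (suc c +_) (distinct j e)))
  (cong suc (trans (length-map (suc c +_) (distinct j e)) (length-distinct j e)))

triangle-suc : ∀ j → (suc j + 1) C 2 ≡ suc j + (j + 1) C 2
triangle-suc j = begin
  (suc j + 1) C 2           ≡⟨ nCk+nC[k+1]≡[n+1]C[k+1] (j + 1) 1 ⟨
  (j + 1) C 1 + (j + 1) C 2 ≡⟨ cong (_+ (j + 1) C 2) (trans (nC1≡n (j + 1)) (+-comm j 1)) ⟩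
  suc j + (j + 1) C 2       ∎
  where open ≡-Reasoning

sum-map-+ : ∀ s τ → sum (map (s +_) τ) ≡ length τ * s + sum τ
sum-map-+ s []      = refl
sum-map-+ s (x ∷ τ) = begin
  s + x + sum (map (s +_) τ)     ≡⟨ cong (s + x +_) (sum-map-+ s τ) ⟩
  s + x + (length τ * s + sum τ) ≡⟨ +-interchange s x (length τ * s) (sum τ) ⟩
  s + length τ * s + (x + sum τ) ∎
  where open ≡-Reasoning

sum-distinct : ∀ j e → sum (distinct j e) ≡ (j + 1) C 2 + xdeg (ProdGeomᶜ j) e
sum-distinct zero    _       = refl
sum-distinct (suc j) (e , c) = begin
  sum (map (suc c +_) τ ∷ʳ suc c)
    ≡⟨ sum-++ (map (suc c +_) τ) (suc c ∷ []) ⟩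
  sum (map (suc c +_) τ) + (suc c + 0)
    ≡⟨ cong₂ _+_ (sum-map-+ (suc c) τ) (+-identityʳ (suc c)) ⟩
  length τ * suc c + sum τ + suc c
    ≡⟨ cong₂ (λ l t → l * suc c + t + suc c) (length-distinct j e) (sum-distinct j e) ⟩
  j * suc c + ((j + 1) C 2 + x) + suc c
    ≡⟨ solve 4 (λ j c t x → j :* (con 1 :+ c) :+ (t :+ x) :+ (con 1 :+ c)
                         := con 1 :+ j :+ t :+ (x :+ c :* (con 1 :+ j))) refl j c ((j + 1) C 2) x ⟩
  suc j + (j + 1) C 2 + (x + c * suc j)
    ≡⟨ cong (_+ (x + c * suc j)) (triangle-suc j) ⟨
  (suc j + 1) C 2 + (x + c * suc j)
    ∎
  where
  open ≡-Reasoning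
  open +-*-Solver
  τ = distinct j e
  x = xdeg (ProdGeomᶜ j) e

DistinctParts-distinct : ∀ j e → DistinctParts (distinct j e)
DistinctParts-distinct zero    _       = [] , []
DistinctParts-distinct (suc j) (e , c) =
  DistinctParts-shift (suc c) (s≤s z≤n) (DistinctParts-distinct j e)

distinct-injective : ∀ j {e e′} → distinct j e ≡ distinct j e′ → e ≡ e′
distinct-injective zero    _ = refl
distinct-injective (suc j) {e , c} {e′ , _} eq with init≡ , refl ← ∷ʳ-injective _ _ eq =
  cong (_, c) (distinct-injective j (map-injective (λ {x} {y} → +-cancelˡ-≡ (suc c) x y) init≡))

distinct-onto : ∀ j σ → DistinctParts σ → length σ ≡ j → Σ (Obj (ProdGeomᶜ j)) λ e → distinct j e ≡ σ
distinct-onto zero    []      _  _    = tt , refl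
distinct-onto (suc j) σ       dp len with initLast σ
distinct-onto (suc j) .[] _ () | []
distinct-onto (suc j) .(τ ∷ʳ zero) (pos , _) _ | τ ∷ʳ′ zero with () ← All.head (All.++⁻ʳ τ pos)
distinct-onto (suc j) .(τ ∷ʳ suc c) dp@(_ , linked) len | τ ∷ʳ′ suc c
  with e , eq ← distinct-onto j (map (_∸ suc c) τ) (DistinctParts-unshift (suc c) τ dp)
                  (trans (length-map _ τ) (suc-injective (trans (sym (length-∷ʳ τ {suc c})) len))) =
  (e , c) , cong (_∷ʳ suc c)
              (trans (cong (map (suc c +_)) eq) (map-+-∸ (All.map <⇒≤ (Linked-∷ʳ⇒All τ linked))))

ydeg-ProdGeomᶜ : ∀ j e → ydeg (ProdGeomᶜ j) e ≡ 0
ydeg-ProdGeomᶜ zero    _       = refl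
ydeg-ProdGeomᶜ (suc j) (e , _) = trans (+-identityʳ _) (ydeg-ProdGeomᶜ j e)

Jᶜ≅DistinctOfLength : ∀ j → Jᶜ j ≅ DistinctOfLength j
Jᶜ≅DistinctOfLength zero = ListEncoding⇒≅ DistinctOfLength-irrelevant record
  { encode           = λ _ → []
  ; encode-valid     = λ _ → ([] , []) , refl
  ; encode-injective = λ _ → refl
  ; decode           = λ { [] _ → tt , refl ; (_ ∷ _) (_ , ()) }
  ; sum-encode       = λ _ → refl
  ; length-encode    = λ _ → refl
  }
Jᶜ≅DistinctOfLength (suc j) = ListEncoding⇒≅ DistinctOfLength-irrelevant record
  { encode           = λ (_ , e) → distinct (suc j) e
  ; encode-valid     = λ (_ , e) → DistinctParts-distinct (suc j) e , length-distinct (suc j) e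
  ; encode-injective = cong (tt ,_) ∘ distinct-injective (suc j)
  ; decode           = λ σ (dp , len) → let e , eq = distinct-onto (suc j) σ dp len in (tt , e) , eq
  ; sum-encode       = λ (_ , e) → sum-distinct (suc j) e
  ; length-encode    = λ (_ , e) → trans (length-distinct (suc j) e)
                         (sym (trans (cong (suc j +_) (ydeg-ProdGeomᶜ (suc j) e)) (+-identityʳ (suc j))))
  }

∅ᶜ≅DistinctShorterThan0 : ∅ᶜ ≅ DistinctShorterThan 0
∅ᶜ≅DistinctShorterThan0 = ListEncoding⇒≅ DistinctShorterThan-irrelevant record
  { encode           = λ ()
  ; encode-valid     = λ ()
  ; encode-injective = λ { {()} }
  ; decode           = λ { _ (_ , ()) }
  ; sum-encode       = λ ()
  ; length-encode    = λ ()
  }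

DistinctShorterThan-suc : ∀ k →
  (DistinctShorterThan k ⊎ᶜ DistinctOfLength k) ≅ DistinctShorterThan (suc k)
DistinctShorterThan-suc k = ListEncoding⇒≅ DistinctShorterThan-irrelevant record
  { encode           = [ proj₁ , proj₁ ]
  ; encode-valid     = [ (λ (_ , dp , len<k) → dp , m≤n⇒m≤1+n len<k)
                         , (λ (_ , dp , len≡k) → dp , s≤s (≤-reflexive len≡k)) ]
  ; encode-injective = injective
  ; decode           = decode
  ; sum-encode       = [ (λ _ → refl) , (λ _ → refl) ]
  ; length-encode    = [ (λ _ → refl) , (λ _ → refl) ]
  }
  where
  injective : ∀ {a b} → [ proj₁ , proj₁ ] a ≡ [ proj₁ , proj₁ ] b → a ≡ b
  injective {inj₁ _} {inj₁ _} eq = cong inj₁ (Σ-≡-irrelevant DistinctShorterThan-irrelevant eq)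
  injective {inj₂ _} {inj₂ _} eq = cong inj₂ (Σ-≡-irrelevant DistinctOfLength-irrelevant eq)
  injective {inj₁ (σ , _ , len<k)} {inj₂ (.σ , _ , len≡k)} refl = contradiction len≡k (<⇒≢ len<k)
  injective {inj₂ (σ , _ , len≡k)} {inj₁ (.σ , _ , len<k)} refl = contradiction len≡k (<⇒≢ len<k)
  decode : ∀ σ → DistinctParts σ × length σ < suc k → Σ _ λ a → [ proj₁ , proj₁ ] a ≡ σ
  decode σ (dp , len≤k) with length σ ≟ k
  ... | yes len≡k = inj₂ (σ , dp , len≡k) , refl
  ... | no  len≢k = inj₁ (σ , dp , ≤∧≢⇒< (≤-pred len≤k) len≢k) , refl

SumJᶜ≅DistinctShorterThan : ∀ k → SumJᶜ k ≅ DistinctShorterThan k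
SumJᶜ≅DistinctShorterThan zero    = ∅ᶜ≅DistinctShorterThan0
SumJᶜ≅DistinctShorterThan (suc k) =
  ≅-trans (≅-⊎ (SumJᶜ≅DistinctShorterThan k) (Jᶜ≅DistinctOfLength k)) (DistinctShorterThan-suc k)

-- Block decomposition of Arndt compositions

T-<ᵇ : ∀ {m n} → T (m <ᵇ n) ⇔ m < n
T-<ᵇ = mk⇔ (<ᵇ⇒< _ _) <⇒<ᵇ

all-++ : ∀ (p : A → Bool) xs ys → all p (xs ++ ys) ≡ all p xs ∧ all p ys
all-++ p []       ys = refl
all-++ p (x ∷ xs) ys = trans (cong (p x ∧_) (all-++ p xs ys)) (sym (∧-assoc (p x) _ _))

++-injective : ∀ (xs xs′ : List A) {ys ys′} → length xs ≡ length xs′ →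
               xs ++ ys ≡ xs′ ++ ys′ → xs ≡ xs′ × ys ≡ ys′
++-injective []       []        _   eq = refl , eq
++-injective (x ∷ xs) (x′ ∷ xs′) len eq with refl , eq′ ← ∷-injective eq =
  map₁ (cong (x ∷_)) (++-injective xs xs′ (suc-injective len) eq′)

length-drop-≤ : ∀ {k f} (σ : List A) → 1 ≤ k → length σ ≤ suc f → length (drop k σ) ≤ f
length-drop-≤ {k = k} {f} σ k≥1 len≤1+f =
  subst (_≤ f) (sym (length-drop k σ)) (≤-trans (∸-monoʳ-≤ (length σ) k≥1) (∸-monoˡ-≤ 1 len≤1+f))

T-isComposition : ∀ σ → T (isComposition σ) ⇔ All (0 <_) σ
T-isComposition []      = mk⇔ (λ _ → []) (λ _ → tt)
T-isComposition (_ ∷ σ) =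
  ⇔-trans T-∧ (⇔-trans (T-<ᵇ ×-⇔ T-isComposition σ) (mk⇔ (λ (p , ps) → p ∷ ps) All.uncons))

decreasingᵇ : List ℕ → Bool
decreasingᵇ []          = true
decreasingᵇ (_ ∷ [])    = true
decreasingᵇ (a ∷ b ∷ σ) = (b <ᵇ a) ∧ decreasingᵇ (b ∷ σ)

T-decreasingᵇ : ∀ σ → T (decreasingᵇ σ) ⇔ Linked _>_ σ
T-decreasingᵇ []          = mk⇔ (λ _ → []) (λ _ → tt)
T-decreasingᵇ (_ ∷ [])    = mk⇔ (λ _ → [-]) (λ _ → tt)
T-decreasingᵇ (_ ∷ b ∷ σ) = ⇔-trans T-∧
  (⇔-trans (T-<ᵇ ×-⇔ T-decreasingᵇ (b ∷ σ))
           (mk⇔ (λ (p , ps) → p ∷ ps) (λ ps → Linked.head ps , Linked.tail ps)))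

isDistinctᵇ : List ℕ → Bool
isDistinctᵇ σ = isComposition σ ∧ decreasingᵇ σ

T-isDistinctᵇ : ∀ σ → T (isDistinctᵇ σ) ⇔ DistinctParts σ
T-isDistinctᵇ σ = ⇔-trans T-∧ (T-isComposition σ ×-⇔ T-decreasingᵇ σ)

adjacentOK-periodic : ∀ k i σ → adjacentOK k (k + i) σ ≡ adjacentOK k i σ
adjacentOK-periodic k i []          = refl
adjacentOK-periodic k i (_ ∷ [])    = refl
adjacentOK-periodic k i (a ∷ b ∷ σ) = cong₂ _∧_
  (cong (λ k∣i → if k∣i then true else (b <ᵇ a))
        (does-⇔ (mk⇔ (λ k∣k+i → ∣m+n∣m⇒∣n k∣k+i ∣-refl) (∣m∣n⇒∣m+n ∣-refl)) (k ∣? (k + i)) (k ∣? i)))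
  (trans (cong (λ p → adjacentOK k p (b ∷ σ)) (sym (+-suc k i))) (adjacentOK-periodic k (suc i) (b ∷ σ)))

adjacentOK-within : ∀ {k i} a ρ → suc i + length ρ ≤ k → adjacentOK k (suc i) (a ∷ ρ) ≡ decreasingᵇ (a ∷ ρ)
adjacentOK-within         a []      _     = refl
adjacentOK-within {k} {i} a (b ∷ ρ) bound
  rewrite dec-false (k ∣? suc i) (>⇒∤ (<-≤-trans (m<m+n (suc i) (s≤s z≤n)) bound)) =
  cong ((b <ᵇ a) ∧_) (adjacentOK-within b ρ (subst (_≤ k) (+-suc (suc i) (length ρ)) bound))

adjacentOK-block : ∀ {k i} a ρ τ → suc i + length ρ ≡ k →
                   adjacentOK k (suc i) (a ∷ ρ ++ τ) ≡ decreasingᵇ (a ∷ ρ) ∧ adjacentOK k (suc k) τ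
adjacentOK-block {k} {i} a [] τ len with refl ← trans (sym (+-identityʳ (suc i))) len = block-end τ
  where
  block-end : ∀ τ → adjacentOK (suc i) (suc i) (a ∷ τ) ≡ adjacentOK (suc i) (suc (suc i)) τ
  block-end []      = refl
  block-end (_ ∷ _) rewrite dec-true (suc i ∣? suc i) ∣-refl = refl
adjacentOK-block {k} {i} a (b ∷ ρ) τ len
  rewrite dec-false (k ∣? suc i) (>⇒∤ (subst (suc i <_) len (m<m+n (suc i) (s≤s z≤n)))) =
  trans (cong ((b <ᵇ a) ∧_) (adjacentOK-block b ρ τ (trans (sym (+-suc (suc i) (length ρ))) len)))
        (sym (∧-assoc (b <ᵇ a) _ _))

isArndt-short : ∀ {k} σ → length σ < k → isArndt k σ ≡ isDistinctᵇ σ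
isArndt-short []      _     = refl
isArndt-short (a ∷ ρ) len<k = cong (isComposition (a ∷ ρ) ∧_) (adjacentOK-within a ρ (<⇒≤ len<k))

isArndt-++ : ∀ {k} b τ → length b ≡ k → isArndt k (b ++ τ) ≡ isDistinctᵇ b ∧ isArndt k τ
isArndt-++ []      τ _ = refl
isArndt-++ {k} (a ∷ ρ) τ len = begin
  isComposition (a ∷ ρ ++ τ) ∧ adjacentOK k 1 (a ∷ ρ ++ τ)
    ≡⟨ cong₂ _∧_ (all-++ _ (a ∷ ρ) τ)
                 (trans (adjacentOK-block a ρ τ len) (cong (decreasingᵇ (a ∷ ρ) ∧_) periodic)) ⟩
  (isComposition (a ∷ ρ) ∧ isComposition τ) ∧ (decreasingᵇ (a ∷ ρ) ∧ adjacentOK k 1 τ)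
    ≡⟨ ∧-interchange (isComposition (a ∷ ρ)) (isComposition τ) (decreasingᵇ (a ∷ ρ)) (adjacentOK k 1 τ) ⟩
  isDistinctᵇ (a ∷ ρ) ∧ isArndt k τ
    ∎
  where
  open ≡-Reasoning
  periodic : adjacentOK k (suc k) τ ≡ adjacentOK k 1 τ
  periodic = trans (cong (λ p → adjacentOK k p τ) (+-comm 1 k)) (adjacentOK-periodic k 1 τ)

isArndt-take-drop : ∀ {k} σ → k ≤ length σ → T (isArndt k σ) →
                    (DistinctParts (take k σ) × length (take k σ) ≡ k) × T (isArndt k (drop k σ))
isArndt-take-drop {k} σ k≤len ok =
  (Equivalence.to (T-isDistinctᵇ (take k σ)) (proj₁ parts) , length-first) , proj₂ parts
  where
  length-first : length (take k σ) ≡ k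
  length-first = trans (length-take k σ) (m≤n⇒m⊓n≡m k≤len)
  ok-split : T (isArndt k (take k σ ++ drop k σ))
  ok-split = subst (T ∘ isArndt k) (sym (take++drop≡id k σ)) ok
  parts : T (isDistinctᵇ (take k σ)) × T (isArndt k (drop k σ))
  parts = Equivalence.to T-∧ (subst T (isArndt-++ (take k σ) (drop k σ) length-first) ok-split)

ArndtClass : ℕ → Class
ArndtClass k = ListClass (T ∘ isArndt k)

Blocks : ℕ → ℕ → Set
Blocks k t = Obj (DistinctOfLength k ^ᶜ t)

arrange : ∀ {k} t → Blocks k t → List ℕ → List ℕ
arrange zero    _        ρ = ρ
arrange (suc t) (b , bs) ρ = proj₁ b ++ arrange t bs ρ

sum-arrange : ∀ {k} t (bs : Blocks k t) ρ →
              sum (arrange {k} t bs ρ) ≡ xdeg (DistinctOfLength k ^ᶜ t) bs + sum ρ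
sum-arrange zero    _             _ = refl
sum-arrange {k} (suc t) ((b , _) , bs) ρ =
  trans (sum-++ b _) (trans (cong (sum b +_) (sum-arrange {k} t bs ρ)) (sym (+-assoc (sum b) _ _)))

length-arrange : ∀ {k} t (bs : Blocks k t) ρ →
                 length (arrange {k} t bs ρ) ≡ ydeg (DistinctOfLength k ^ᶜ t) bs + length ρ
length-arrange zero    _             _ = refl
length-arrange {k} (suc t) ((b , _) , bs) ρ =
  trans (length-++ b) (trans (cong (length b +_) (length-arrange {k} t bs ρ)) (sym (+-assoc (length b) _ _)))

length-arrange-suc≥ : ∀ {k} t (bs : Blocks k (suc t)) ρ → k ≤ length (arrange (suc t) bs ρ)
length-arrange-suc≥ t ((b , _ , len) , bs) ρ = subst (_≤ length (b ++ arrange t bs ρ)) len (length-++-≤ˡ b)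

isArndt-arrange : ∀ {k} t (bs : Blocks k t) (r : Obj (DistinctShorterThan k)) →
                  T (isArndt k (arrange t bs (proj₁ r)))
isArndt-arrange zero    _ (ρ , dp , len<k) rewrite isArndt-short ρ len<k =
  Equivalence.from (T-isDistinctᵇ ρ) dp
isArndt-arrange (suc t) ((b , dp , len) , bs) r rewrite isArndt-++ b (arrange t bs (proj₁ r)) len =
  Equivalence.from T-∧ (Equivalence.from (T-isDistinctᵇ b) dp , isArndt-arrange t bs r)

arrange-injective : ∀ {k} t t′ (bs : Blocks k t) (bs′ : Blocks k t′)
                    (r r′ : Obj (DistinctShorterThan k)) →
                    arrange t bs (proj₁ r) ≡ arrange t′ bs′ (proj₁ r′) → ((t , bs) , r) ≡ ((t′ , bs′) , r′)
arrange-injective zero zero _ _ _ _ eq =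
  cong ((zero , tt) ,_) (Σ-≡-irrelevant DistinctShorterThan-irrelevant eq)
arrange-injective {k} zero (suc t′) _ bs′ (_ , _ , len<k) r′ eq =
  contradiction (subst (λ σ → k ≤ length σ) (sym eq) (length-arrange-suc≥ t′ bs′ (proj₁ r′))) (<⇒≱ len<k)
arrange-injective {k} (suc t) zero bs _ r (_ , _ , len<k) eq =
  contradiction (subst (λ σ → k ≤ length σ) eq (length-arrange-suc≥ t bs (proj₁ r))) (<⇒≱ len<k)
arrange-injective (suc t) (suc t′) ((b , _ , len) , bs) ((b′ , _ , len′) , bs′) r r′ eq
  with b≡b′ , rest≡ ← ++-injective b b′ (trans len (sym len′)) eq =
  cong₂ (λ b ((t , bs) , r) → (suc t , b , bs) , r)
        (Σ-≡-irrelevant DistinctOfLength-irrelevant b≡b′)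
        (arrange-injective t t′ bs bs′ r r′ rest≡)

Arndt-decomposition : ∀ {k} → 1 ≤ k → (Seq (DistinctOfLength k) ×ᶜ DistinctShorterThan k) ≅ ArndtClass k
Arndt-decomposition {k} k≥1 = ListEncoding⇒≅ T-irrelevant record
  { encode           = encode
  ; encode-valid     = λ ((t , bs) , r) → isArndt-arrange t bs r
  ; encode-injective = λ {((t , bs) , r)} {((t′ , bs′) , r′)} → arrange-injective t t′ bs bs′ r r′
  ; decode           = λ σ ok → split (length σ) σ ≤-refl ok
  ; sum-encode       = λ ((t , bs) , (ρ , _)) → sum-arrange {k} t bs ρ
  ; length-encode    = λ ((t , bs) , (ρ , _)) → length-arrange {k} t bs ρ
  }
  where
  X = Seq (DistinctOfLength k) ×ᶜ DistinctShorterThan k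
  encode : Obj X → List ℕ
  encode ((t , bs) , (ρ , _)) = arrange t bs ρ
  split : ∀ fuel σ → length σ ≤ fuel → T (isArndt k σ) → Σ (Obj X) λ a → encode a ≡ σ
  split fuel σ len≤fuel ok with length σ <? k
  split _       σ _       ok | yes len<k =
    ((zero , tt) , σ , Equivalence.to (T-isDistinctᵇ σ) (subst T (isArndt-short σ len<k) ok) , len<k) , refl
  split zero    σ len≤0   _  | no  len≮k with () ← ≤-trans k≥1 (≤-trans (≮⇒≥ len≮k) len≤0)
  split (suc f) σ len≤1+f ok | no  len≮k
    with block , ok-rest ← isArndt-take-drop σ (≮⇒≥ len≮k) ok
    with ((t , bs) , r) , eq ← split f (drop k σ) (length-drop-≤ σ k≥1 len≤1+f) ok-rest =
    ((suc t , (take k σ , block) , bs) , r) , trans (cong (take k σ ++_) eq) (take++drop≡id k σ)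

Fiber-ArndtClass : ∀ k n m → Fiber (ArndtClass k) n m ↔ Arndt k n m
Fiber-ArndtClass k n m = ↔-trans Σ-assoc (Σ-↔ ↔-refl (⇔⇒↔
  (×-irrelevant T-irrelevant (×-irrelevant ≡-irrelevant ≡-irrelevant)) T-irrelevant
  (⇔-sym (⇔-trans T-∧ (⇔-refl ×-⇔ (⇔-trans T-∧ (T-≡ᵇ ×-⇔ T-≡ᵇ)))))))

-- Opened only here: an unqualified +_ makes the sections (n +_) above ambiguous.
open import Data.Integer using (+_)

theorem5p1 : (k : ℕ) → 1 ≤ k → (n m : ℕ) →
    Σ ℕ λ c → (Fin c ↔ Arndt k n m) × (+ c ≡ rhs k n m)
theorem5p1 k k≥1 n m = HasCard-↔ (HasGF-≅ (HasGF-rhs k≥1) decomposition n m) (Fiber-ArndtClass k n m)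
  where
  decomposition : (Seq (Jᶜ k) ×ᶜ SumJᶜ k) ≅ ArndtClass k
  decomposition = ≅-trans (≅-× (≅-Seq (Jᶜ≅DistinctOfLength k)) (SumJᶜ≅DistinctShorterThan k))
                          (Arndt-decomposition k≥1)
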